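{- $\tau(n)\to\infty$ as $n\to\infty$.
   Context: A binary rooted phylogenetic tree of order $n$ is a rooted tree, edges directed away from the root, root of out-degree 2, other internal vertices of in-degree 1 and out-degree 2, with $n$ leaves bijectively labelled by $\{1,\dots,n\}$. Such a tree $T$ displays the triplet $ab|c$ if $\mathrm{lca}_{T}(a,c)=\mathrm{lca}_{T}(b,c)$ is a proper ancestor of $\mathrm{lca}_{T}(a,b)$. $\mathcal{T}_n=\{ab|c: a,b,c\in\{1,\dots,n\}\text{ pairwise distinct}\}$ (with $ab|c=ba|c$). $\tau(n)$ is the minimum number of binary rooted phylogenetic trees of order $n$ such that each triplet in $\mathcal{T}_n$ is displayed by at least one of them. -}

module Defs where

open import Data.Nat using (ℕ; _≤_)
open import Data.Fin using (Fin)
open import Data.List using (List; []; _∷_; _++_; length; allFin)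
open import Data.List.Relation.Binary.Permutation.Propositional using (_↭_)
open import Data.List.Relation.Unary.Any using (Any)
open import Data.Product using (Σ; _×_; _,_; ∃-syntax)
open import Relation.Binary.PropositionalEquality using (_≡_; _≢_)

-- Rooted binary trees with leaves labelled by Fin n (label i stands for i+1).
data BTree (n : ℕ) : Set where
  leaf : Fin n → BTree n
  node : BTree n → BTree n → BTree n

leaves : ∀ {n} → BTree n → List (Fin n)
leaves (leaf a)   = a ∷ []
leaves (node l r) = leaves l ++ leaves r

PhyloTree : ℕ → Set
PhyloTree n = Σ (BTree n) (λ t → leaves t ↭ allFin n)

-- s ⊑ t : (the vertex) s is a descendant of (or equal to) t, i.e. a subtree.
data _⊑_ {n : ℕ} : BTree n → BTree n → Set where
  here  : ∀ {t} → t ⊑ t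
  left  : ∀ {s l r} → s ⊑ l → s ⊑ node l r
  right : ∀ {s l r} → s ⊑ r → s ⊑ node l r

IsLca : ∀ {n} → BTree n → Fin n → Fin n → BTree n → Set
IsLca t a b u =
  u ⊑ t × leaf a ⊑ u × leaf b ⊑ u ×
  (∀ w → w ⊑ t → leaf a ⊑ w → leaf b ⊑ w → u ⊑ w)

_⊏_ : ∀ {n} → BTree n → BTree n → Set
u ⊏ v = u ⊑ v × u ≢ v

-- T displays ab|c : lca(a,c) = lca(b,c) is a proper ancestor of lca(a,b)
Displays : ∀ {n} → PhyloTree n → Fin n → Fin n → Fin n → Set
Displays (t , _) a b c =
  ∃[ u ] ∃[ v ] (IsLca t a b u × IsLca t a c v × IsLca t b c v × u ⊏ v)

Covers : ∀ {n} → List (PhyloTree n) → Set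
Covers {n} Ts = ∀ (a b c : Fin n) → a ≢ b → a ≢ c → b ≢ c →
  Any (λ T → Displays T a b c) Ts

-- Reading the leaves of a tree T from left to right gives a linear order of
-- the labels.  If T displays ac|b, the vertex lca(a,c) has a and c below it
-- but not b; its leaves form a contiguous segment of the left-to-right order,
-- so b does not lie between a and c in that order.
--
-- Conversely, given k trees, an iterated Erdős–Szekeres argument extracts,
-- from a long enough list of labels, three labels a, b, c whose positions are
-- monotone in every one of the k leaf orders; then b lies between a and c in
-- every tree, so the triplet ac|b is displayed by none of them.
module Submission where

open import Defs
open import Data.Nat using (ℕ; _≤_)
open import Data.List using (List; length)
open import Data.Product using (∃-syntax)

open import Data.Nat using (zero; suc; _+_; _<_; z≤n; s≤s; _≤?_)
open import Data.Nat.Properties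
open import Data.Fin as Fin using (Fin)
open import Data.List using ([]; _∷_; _++_; allFin)
open import Data.List.Properties using (++-assoc; ++-identityʳ; length-tabulate)
open import Data.List.Relation.Unary.All as All using (All; []; _∷_)
open import Data.List.Relation.Unary.Any as Any using (Any; here; there)
open import Data.List.Relation.Unary.AllPairs using (AllPairs; []; _∷_)
open import Data.List.Relation.Unary.Unique.Propositional using (Unique)
open import Data.List.Relation.Unary.Unique.Propositional.Properties using (allFin⁺)
open import Data.List.Relation.Binary.Sublist.Propositional
  using (_⊆_; []; _∷_; _∷ʳ_; ⊆-refl; ⊆-trans; minimum)
open import Data.List.Relation.Binary.Sublist.Propositional.Properties using (All-resp-⊆)
open import Data.List.Relation.Binary.Permutation.Propositional using (_↭_; ↭-sym; ↭⇒↭ₛ)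
import Data.List.Relation.Binary.Permutation.Setoid.Properties as PermutationProperties
open import Data.List.Membership.Propositional using (_∈_; _∉_)
open import Data.List.Membership.Propositional.Properties using (∈-++⁺ˡ; ∈-++⁺ʳ; ∈-++⁻)
import Data.List.Membership.DecPropositional as DecMembership
open import Data.Product using (_×_; _,_)
open import Data.Sum using (_⊎_; inj₁; inj₂)
open import Data.Empty using (⊥-elim)
open import Relation.Nullary using (¬_; yes; no)
open import Relation.Binary.Definitions using (DecidableEquality)
open import Relation.Binary.PropositionalEquality
  using (_≡_; refl; sym; trans; cong; subst; setoid; module ≡-Reasoning)

AllPairs-resp-⊇ : ∀ {A : Set} {R : A → A → Set} {xs ys : List A} →
  xs ⊆ ys → AllPairs R ys → AllPairs R xs
AllPairs-resp-⊇ [] [] = []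
AllPairs-resp-⊇ (y ∷ʳ τ) (_ ∷ rs) = AllPairs-resp-⊇ τ rs
AllPairs-resp-⊇ (refl ∷ τ) (r ∷ rs) = All-resp-⊆ τ r ∷ AllPairs-resp-⊇ τ rs

Unique-resp-↭ : ∀ {A : Set} {xs ys : List A} →
  xs ↭ ys → Unique ys → Unique xs
Unique-resp-↭ {A} p = PermutationProperties.Unique-resp-↭ (setoid A) (↭⇒↭ₛ (↭-sym p))

Unique-++-disjoint : ∀ {A : Set} {a : A} (xs zs : List A) →
  Unique (xs ++ zs) → a ∈ zs → a ∉ xs
Unique-++-disjoint (x ∷ xs) zs (x∉rest ∷ _) a∈zs (here a≡x) =
  All.lookup x∉rest (∈-++⁺ʳ xs a∈zs) (sym a≡x)
Unique-++-disjoint (x ∷ xs) zs (_ ∷ u) a∈zs (there a∈xs) =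
  Unique-++-disjoint xs zs u a∈zs a∈xs

module _ {A : Set} (f : A → ℕ) where

  NonDecreasing NonIncreasing Monotone : List A → Set
  NonDecreasing = AllPairs (λ x y → f x ≤ f y)
  NonIncreasing = AllPairs (λ x y → f y ≤ f x)
  Monotone ys = NonDecreasing ys ⊎ NonIncreasing ys

  Monotone-resp-⊇ : ∀ {xs ys} → xs ⊆ ys → Monotone ys → Monotone xs
  Monotone-resp-⊇ τ (inj₁ m) = inj₁ (AllPairs-resp-⊇ τ m)
  Monotone-resp-⊇ τ (inj₂ m) = inj₂ (AllPairs-resp-⊇ τ m)

  record Partition (v : ℕ) (ys : List A) : Set where
    field
      above below  : List A
      above⊆       : above ⊆ ys
      below⊆       : below ⊆ ys
      all-above    : All (λ y → v ≤ f y) above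
      all-below    : All (λ y → f y ≤ v) below
      length-split : length above + length below ≡ length ys

  partition : ∀ v ys → Partition v ys
  partition v [] = record
    { above = []; below = []; above⊆ = []; below⊆ = []
    ; all-above = []; all-below = []; length-split = refl }
  partition v (y ∷ ys) with partition v ys | v ≤? f y
  ... | P | yes v≤fy = record
    { above = y ∷ above; below = below
    ; above⊆ = refl ∷ above⊆; below⊆ = y ∷ʳ below⊆
    ; all-above = v≤fy ∷ all-above; all-below = all-below
    ; length-split = cong suc length-split }
    where open Partition P
  ... | P | no v≰fy = record
    { above = above; below = y ∷ below
    ; above⊆ = y ∷ʳ above⊆; below⊆ = refl ∷ below⊆
    ; all-above = all-above; all-below = <⇒≤ (≰⇒> v≰fy) ∷ all-below
    ; length-split = trans (+-suc (length above) (length below)) (cong suc length-split) }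
    where open Partition P

-- The Erdős–Szekeres bound: R p q elements always contain a non-decreasing
-- run of length p or a non-increasing one of length q.
R : ℕ → ℕ → ℕ
R zero q = 0
R (suc p) zero = 0
R (suc p) (suc q) = suc (R p (suc q) + R (suc p) q)

-- R grows at least linearly; this makes the iterated bound monotone.
R-grows : ∀ p q → p ≤ R p (suc q)
R-grows zero q = z≤n
R-grows (suc p) q = s≤s (≤-trans (R-grows p q) (m≤m+n _ _))

R-diagonal : ∀ p → p ≤ R p p
R-diagonal zero = z≤n
R-diagonal (suc p) = R-grows (suc p) p

-- The head x splits the rest
-- by f x; if the part above f x is long enough we recurse there and x may
-- start an increasing run, otherwise the part below f x is long enough.
erdős-szekeres : ∀ {A : Set} (f : A → ℕ) p q (xs : List A) → R p q ≤ length xs →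
  ∃[ ys ] (ys ⊆ xs ×
    ((p ≤ length ys × NonDecreasing f ys) ⊎ (q ≤ length ys × NonIncreasing f ys)))
erdős-szekeres f zero q xs _ = [] , minimum xs , inj₁ (z≤n , [])
erdős-szekeres f (suc p) zero xs _ = [] , minimum xs , inj₂ (z≤n , [])
erdős-szekeres f (suc p) (suc q) (x ∷ xs) (s≤s bound)
  with partition f (f x) xs
... | P with R p (suc q) ≤? length (Partition.above P)
...   | yes long-above with erdős-szekeres f p (suc q) (Partition.above P) long-above
...     | ys , τ , inj₁ (len , inc) =
          x ∷ ys , refl ∷ ⊆-trans τ (Partition.above⊆ P) ,
          inj₁ (s≤s len , All-resp-⊆ τ (Partition.all-above P) ∷ inc)
...     | ys , τ , inj₂ dec = ys , x ∷ʳ ⊆-trans τ (Partition.above⊆ P) , inj₂ dec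
erdős-szekeres f (suc p) (suc q) (x ∷ xs) (s≤s bound) | P | no short-above
  with erdős-szekeres f (suc p) q (Partition.below P) long-below
  where
  open Partition P
  long-below : R (suc p) q ≤ length below
  long-below = +-cancelˡ-≤ (R p (suc q)) _ _ (begin
    R p (suc q) + R (suc p) q   ≤⟨ bound ⟩
    length xs                   ≡⟨ sym length-split ⟩
    length above + length below ≤⟨ +-monoˡ-≤ (length below) (<⇒≤ (≰⇒> short-above)) ⟩
    R p (suc q) + length below  ∎)
    where open ≤-Reasoning
... | ys , τ , inj₁ inc = ys , x ∷ʳ ⊆-trans τ (Partition.below⊆ P) , inj₁ inc
... | ys , τ , inj₂ (len , dec) =
      x ∷ ys , refl ∷ ⊆-trans τ (Partition.below⊆ P) ,
      inj₂ (s≤s len , All-resp-⊆ τ (Partition.all-below P) ∷ dec)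

monotone-sublist : ∀ {A : Set} (f : A → ℕ) m (xs : List A) → R m m ≤ length xs →
  ∃[ ys ] (ys ⊆ xs × m ≤ length ys × Monotone f ys)
monotone-sublist f m xs bound with erdős-szekeres f m m xs bound
... | ys , τ , inj₁ (len , inc) = ys , τ , len , inj₁ inc
... | ys , τ , inj₂ (len , dec) = ys , τ , len , inj₂ dec

-- Any threshold k elements contain three that are monotone for k given keys.
threshold : ℕ → ℕ
threshold zero = 3
threshold (suc k) = R (threshold k) (threshold k)

threshold-mono : ∀ {k l} → k ≤ l → threshold k ≤ threshold l
threshold-mono {l = zero} z≤n = ≤-refl
threshold-mono {k} {suc l} k≤1+l with m≤n⇒m<n∨m≡n k≤1+l
... | inj₂ refl = ≤-refl
... | inj₁ (s≤s k≤l) = ≤-trans (threshold-mono k≤l) (R-diagonal (threshold l))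

common-monotone-triple : ∀ {A B : Set} (key : B → A → ℕ) (Ts : List B) (xs : List A) →
  threshold (length Ts) ≤ length xs →
  ∃[ ys ] (ys ⊆ xs × 3 ≤ length ys × All (λ T → Monotone (key T) ys) Ts)
common-monotone-triple key [] xs bound = xs , ⊆-refl , bound , []
common-monotone-triple key (T ∷ Ts) xs bound
  with monotone-sublist (key T) (threshold (length Ts)) xs bound
... | zs , zs⊆xs , long , mono-zs with common-monotone-triple key Ts zs long
...   | ys , ys⊆zs , three , monos =
        ys , ⊆-trans ys⊆zs zs⊆xs , three , Monotone-resp-⊇ (key T) ys⊆zs mono-zs ∷ monos

Between : ℕ → ℕ → ℕ → Set
Between x y z = (x ≤ y × y ≤ z) ⊎ (z ≤ y × y ≤ x)

monotone-between : ∀ {A : Set} {f : A → ℕ} {a b c : A} {zs : List A} →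
  Monotone f (a ∷ b ∷ c ∷ zs) → Between (f a) (f b) (f c)
monotone-between (inj₁ ((a≤b ∷ _) ∷ (b≤c ∷ _) ∷ _)) = inj₁ (a≤b , b≤c)
monotone-between (inj₂ ((b≤a ∷ _) ∷ (c≤b ∷ _) ∷ _)) = inj₂ (c≤b , b≤a)

between-interval : ∀ {lo hi x y z} → lo ≤ x → x < hi → lo ≤ z → z < hi →
  Between x y z → lo ≤ y × y < hi
between-interval lo≤x _ _ z<hi (inj₁ (x≤y , y≤z)) = ≤-trans lo≤x x≤y , ≤-<-trans y≤z z<hi
between-interval _ x<hi lo≤z _ (inj₂ (z≤y , y≤x)) = ≤-trans lo≤z z≤y , ≤-<-trans y≤x x<hi

module Positions {A : Set} (_≟_ : DecidableEquality A) where

  open DecMembership _≟_ using (_∈?_)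

  -- Index of the first occurrence of a in the list (its length if absent).
  position : List A → A → ℕ
  position [] a = 0
  position (x ∷ xs) a with x ≟ a
  ... | yes _ = 0
  ... | no _ = suc (position xs a)

  position-++-∈ : ∀ {a} (xs ys : List A) → a ∈ xs → position (xs ++ ys) a < length xs
  position-++-∈ {a} (x ∷ xs) ys a∈ with x ≟ a
  ... | yes _ = s≤s z≤n
  position-++-∈ (x ∷ xs) ys (here a≡x) | no x≢a = ⊥-elim (x≢a (sym a≡x))
  position-++-∈ (x ∷ xs) ys (there a∈xs) | no _ = s≤s (position-++-∈ xs ys a∈xs)

  position-++-∉ : ∀ {a} (xs ys : List A) → a ∉ xs →
    position (xs ++ ys) a ≡ length xs + position ys a
  position-++-∉ [] ys _ = refl
  position-++-∉ {a} (x ∷ xs) ys a∉ with x ≟ a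
  ... | yes x≡a = ⊥-elim (a∉ (here (sym x≡a)))
  ... | no _ = cong suc (position-++-∉ xs ys (λ a∈xs → a∉ (there a∈xs)))

  in-window : ∀ {a} (xs M ys : List A) → a ∉ xs → a ∈ M →
    length xs ≤ position (xs ++ M ++ ys) a × position (xs ++ M ++ ys) a < length xs + length M
  in-window {a} xs M ys a∉xs a∈M rewrite position-++-∉ xs (M ++ ys) a∉xs =
    m≤m+n (length xs) _ , +-monoʳ-< (length xs) (position-++-∈ M ys a∈M)

  off-window : ∀ {b} (xs M ys : List A) → b ∉ M →
    position (xs ++ M ++ ys) b < length xs ⊎ length xs + length M ≤ position (xs ++ M ++ ys) b
  off-window {b} xs M ys b∉M with b ∈? xs
  ... | yes b∈xs = inj₁ (position-++-∈ xs (M ++ ys) b∈xs)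
  ... | no b∉xs = inj₂ (begin
    length xs + length M                       ≤⟨ m≤m+n _ _ ⟩
    length xs + length M + position ys b       ≡⟨ +-assoc (length xs) _ _ ⟩
    length xs + (length M + position ys b)     ≡⟨ cong (length xs +_) (sym (position-++-∉ M ys b∉M)) ⟩
    length xs + position (M ++ ys) b           ≡⟨ sym (position-++-∉ xs (M ++ ys) b∉xs) ⟩
    position (xs ++ M ++ ys) b                 ∎)
    where open ≤-Reasoning

  segment-convex : ∀ {a b c} {L} (xs M ys : List A) → L ≡ xs ++ M ++ ys → Unique L →
    a ∈ M → c ∈ M → Between (position L a) (position L b) (position L c) → b ∈ M
  segment-convex {a} {b} {c} xs M ys refl unique a∈M c∈M between with b ∈? M
  ... | yes b∈M = b∈M
  ... | no b∉M
    with in-window xs M ys (Unique-++-disjoint xs (M ++ ys) unique (∈-++⁺ˡ a∈M)) a∈M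
       | in-window xs M ys (Unique-++-disjoint xs (M ++ ys) unique (∈-++⁺ˡ c∈M)) c∈M
  ... | a-lo , a-hi | c-lo , c-hi
    with between-interval a-lo a-hi c-lo c-hi between | off-window xs M ys b∉M
  ... | lo≤b , _ | inj₁ b<lo = ⊥-elim (≤⇒≯ lo≤b b<lo)
  ... | _ , b<hi | inj₂ hi≤b = ⊥-elim (≤⇒≯ hi≤b b<hi)

leaves-segment : ∀ {n} {s t : BTree n} → s ⊑ t →
  ∃[ xs ] ∃[ ys ] (leaves t ≡ xs ++ leaves s ++ ys)
leaves-segment {s = s} here = [] , [] , sym (++-identityʳ (leaves s))
leaves-segment {s = s} {node l r} (left s⊑l) with leaves-segment s⊑l
... | xs , ys , eq = xs , ys ++ leaves r , (begin
  leaves l ++ leaves r                  ≡⟨ cong (_++ leaves r) eq ⟩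
  (xs ++ leaves s ++ ys) ++ leaves r    ≡⟨ ++-assoc xs _ _ ⟩
  xs ++ (leaves s ++ ys) ++ leaves r    ≡⟨ cong (xs ++_) (++-assoc (leaves s) ys _) ⟩
  xs ++ leaves s ++ ys ++ leaves r      ∎)
  where open ≡-Reasoning
leaves-segment {s = s} {node l r} (right s⊑r) with leaves-segment s⊑r
... | xs , ys , eq = leaves l ++ xs , ys , (begin
  leaves l ++ leaves r                  ≡⟨ cong (leaves l ++_) eq ⟩
  leaves l ++ xs ++ leaves s ++ ys      ≡⟨ sym (++-assoc (leaves l) xs _) ⟩
  (leaves l ++ xs) ++ leaves s ++ ys    ∎)
  where open ≡-Reasoning

∈-leaves⇒⊑ : ∀ {n} {x : Fin n} (s : BTree n) → x ∈ leaves s → leaf x ⊑ s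
∈-leaves⇒⊑ (leaf a) (here refl) = here
∈-leaves⇒⊑ (node l r) x∈ with ∈-++⁻ (leaves l) x∈
... | inj₁ x∈l = left (∈-leaves⇒⊑ l x∈l)
... | inj₂ x∈r = right (∈-leaves⇒⊑ r x∈r)

⊑⇒∈-leaves : ∀ {n} {x : Fin n} {s : BTree n} → leaf x ⊑ s → x ∈ leaves s
⊑⇒∈-leaves here = here refl
⊑⇒∈-leaves {s = node l r} (left x⊑l) = ∈-++⁺ˡ (⊑⇒∈-leaves x⊑l)
⊑⇒∈-leaves {s = node l r} (right x⊑r) = ∈-++⁺ʳ (leaves l) (⊑⇒∈-leaves x⊑r)

-- Number of vertices; it strictly decreases towards the leaves, which makes
-- the descendant relation antisymmetric.
size : ∀ {n} → BTree n → ℕ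
size (leaf _) = 1
size (node l r) = suc (size l + size r)

⊑⇒size≤ : ∀ {n} {s t : BTree n} → s ⊑ t → size s ≤ size t
⊑⇒size≤ here = ≤-refl
⊑⇒size≤ {t = node l r} (left s⊑l) = ≤-trans (⊑⇒size≤ s⊑l) (m≤n⇒m≤1+n (m≤m+n (size l) (size r)))
⊑⇒size≤ {t = node l r} (right s⊑r) = ≤-trans (⊑⇒size≤ s⊑r) (m≤n⇒m≤1+n (m≤n+m (size r) (size l)))

⊑-antisym : ∀ {n} {s t : BTree n} → s ⊑ t → t ⊑ s → s ≡ t
⊑-antisym here _ = refl
⊑-antisym {t = node l r} (left s⊑l) t⊑s =
  ⊥-elim (≤⇒≯ (≤-trans (⊑⇒size≤ t⊑s) (⊑⇒size≤ s⊑l)) (s≤s (m≤m+n (size l) (size r))))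
⊑-antisym {t = node l r} (right s⊑r) t⊑s =
  ⊥-elim (≤⇒≯ (≤-trans (⊑⇒size≤ t⊑s) (⊑⇒size≤ s⊑r)) (s≤s (m≤n+m (size r) (size l))))

-- If T displays ac|b, the vertex lca(a,c) has a and c but not b below it:
-- otherwise it would be below lca(a,b), hence equal to it.
displays⇒separating-vertex : ∀ {n} {t : BTree n} {p} {a b c : Fin n} →
  Displays (t , p) a c b → ∃[ u ] (u ⊑ t × a ∈ leaves u × c ∈ leaves u × b ∉ leaves u)
displays⇒separating-vertex
  (u , v , (u⊑t , a⊑u , c⊑u , _) , (_ , _ , _ , v-least) , _ , (u⊑v , u≢v)) =
  u , u⊑t , ⊑⇒∈-leaves a⊑u , ⊑⇒∈-leaves c⊑u ,
  λ b∈u → u≢v (⊑-antisym u⊑v (v-least u u⊑t a⊑u (∈-leaves⇒⊑ u b∈u)))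

leafPosition : ∀ {n} → PhyloTree n → Fin n → ℕ
leafPosition {n} (t , _) = Positions.position (Fin._≟_ {n}) (leaves t)

displays⇒¬between : ∀ {n} (T : PhyloTree n) {a b c : Fin n} → Displays T a c b →
  ¬ Between (leafPosition T a) (leafPosition T b) (leafPosition T c)
displays⇒¬between {n} (t , perm) disp between
  with displays⇒separating-vertex {p = perm} disp
... | u , u⊑t , a∈u , c∈u , b∉u with leaves-segment u⊑t
...   | xs , ys , segment =
        b∉u (Positions.segment-convex Fin._≟_ xs (leaves u) ys segment unique a∈u c∈u between)
  where
  unique : Unique (leaves t)
  unique = Unique-resp-↭ perm (allFin⁺ n)

-- Fewer trees than the threshold allows cannot display every triplet: the
-- common monotone triple a, b, c leaves ac|b undisplayed.
few-trees-do-not-cover : ∀ {n} (Ts : List (PhyloTree n)) →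
  threshold (length Ts) ≤ n → ¬ Covers Ts
few-trees-do-not-cover {n} Ts bound covers
  with common-monotone-triple leafPosition Ts (allFin n)
         (subst (threshold (length Ts) ≤_) (sym (length-tabulate (λ i → i))) bound)
... | a ∷ b ∷ c ∷ _ , triple⊆ , s≤s (s≤s (s≤s _)) , monos
  with AllPairs-resp-⊇ triple⊆ (allFin⁺ n)
... | (a≢b ∷ a≢c ∷ _) ∷ (b≢c ∷ _) ∷ _
  with covers a c b a≢c a≢b (λ c≡b → b≢c (sym c≡b))
... | displayed with All.lookupAny monos displayed
...   | mono , disp = displays⇒¬between (Any.lookup displayed) disp (monotone-between mono)

theorem20 : ∀ (K : ℕ) → ∃[ N ] (∀ (n : ℕ) → N ≤ n →
    (Ts : List (PhyloTree n)) → Covers Ts → K ≤ length Ts)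
theorem20 K = threshold K , at-least-K
  where
  at-least-K : ∀ n → threshold K ≤ n → (Ts : List (PhyloTree n)) → Covers Ts → K ≤ length Ts
  at-least-K n K-bound Ts covers with K ≤? length Ts
  ... | yes enough = enough
  ... | no too-few = ⊥-elim (few-trees-do-not-cover Ts
          (≤-trans (threshold-mono (<⇒≤ (≰⇒> too-few))) K-bound) covers)
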